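{- Let $G=(X\cup Y,E)$ be a bipartite chain graph that is not complete bipartite, with chain ordering $\sigma_X=(x_1,\dots,x_{n_1})$, $\sigma_Y=(y_1,\dots,y_{n_2})$, and let $t$ be the maximum integer such that $G$ contains $K_{t,t}$ as an induced subgraph; let $X_t=\{x_1,\dots,x_t\}$. Suppose $x_ty_{t+1}\in E$, $x_{t+1}y_t\notin E$ and $x_{t+1}y_{t-1}\notin E$ (i.e., $G$ is a Type-II(a) BCG). If there exist vertices $z_1,\dots,z_{t-1}$ in $(X\setminus X_t)\cup\{y_{t+2},y_{t+3},\dots,y_{n_2}\}$ such that $t-j\ge |N(z_j)|\ge t-j-1$ for all $1\le j\le t-1$, then $TTr(G)=Tr(G)=t+1$.
   Context: All graphs are finite and simple; $N(v)$ is the set of neighbours of $v$. For disjoint vertex sets $A,B$, $A$ dominates $B$ if every vertex of $B$ has a neighbour in $A$. A transitive partition of order $k$ of $G=(V,E)$ is a partition $\{V_1,\dots,V_k\}$ of $V$ into nonempty sets with $V_i$ dominating $V_j$ for all $1\le i<j\le k$; the transitivity $Tr(G)$ is the maximum such $k$. A tournament transitive partition additionally requires that $V_j$ does not dominate $V_i$ for all $i<j$; the tournament transitivity $TTr(G)$ is the maximum order of such a partition. A bipartite graph $G=(X\cup Y,E)$ is a bipartite chain graph if there are orderings (chain orderings) $\sigma_X=(x_1,\dots,x_{n_1})$ of $X$ and $\sigma_Y=(y_1,\dots,y_{n_2})$ of $Y$ with $N(x_{n_1})\subseteq\cdots\subseteq N(x_1)$ and $N(y_{n_2})\subseteq\cdots\subseteq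 N(y_1)$. -}

module Defs where

open import Data.Nat using (ℕ; zero; suc; _+_; _∸_; _≤_; _<_)
open import Data.Fin using (Fin; toℕ)
import Data.Fin as F
open import Data.Bool using (Bool; true; false)
open import Data.Sum using (_⊎_; inj₁; inj₂)
open import Data.Product using (Σ; ∃; _×_; _,_)
open import Data.Empty using (⊥)
open import Relation.Nullary using (¬_)
open import Relation.Binary.PropositionalEquality using (_≡_; _≢_)
open import Function.Definitions using (Injective)

-- A bipartite graph with parts X = Fin n₁ (x₁,…,x_{n₁} ↦ 0,…,n₁-1)
-- and Y = Fin n₂, given by its bi-adjacency E : X → Y → Bool.
-- Vertex set V = X ⊎ Y.

Vtx : ℕ → ℕ → Set
Vtx n₁ n₂ = Fin n₁ ⊎ Fin n₂

Adj : ∀ {n₁ n₂} → (Fin n₁ → Fin n₂ → Bool) → Vtx n₁ n₂ → Vtx n₁ n₂ → Set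
Adj E (inj₁ a) (inj₁ a') = ⊥
Adj E (inj₁ a) (inj₂ b)  = E a b ≡ true
Adj E (inj₂ b) (inj₁ a)  = E a b ≡ true
Adj E (inj₂ b) (inj₂ b') = ⊥

IsChainOrdered : ∀ {n₁ n₂} → (Fin n₁ → Fin n₂ → Bool) → Set
IsChainOrdered {n₁} {n₂} E =
  (∀ (i i' : Fin n₁) (b : Fin n₂) → toℕ i ≤ toℕ i' → E i' b ≡ true → E i b ≡ true)
  × (∀ (j j' : Fin n₂) (a : Fin n₁) → toℕ j ≤ toℕ j' → E a j' ≡ true → E a j ≡ true)

IsCompleteBipartite : ∀ {n₁ n₂} → (Fin n₁ → Fin n₂ → Bool) → Set
IsCompleteBipartite E = ∀ a b → E a b ≡ true

HasInducedKtt : ∀ {n₁ n₂} → (Fin n₁ → Fin n₂ → Bool) → ℕ → Set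
HasInducedKtt {n₁} {n₂} E t =
  Σ (Fin t → Vtx n₁ n₂) λ a → Σ (Fin t → Vtx n₁ n₂) λ b →
    Injective _≡_ _≡_ a × Injective _≡_ _≡_ b
    × (∀ i j → a i ≢ b j)
    × (∀ i j → Adj E (a i) (b j))
    × (∀ i j → ¬ Adj E (a i) (a j))
    × (∀ i j → ¬ Adj E (b i) (b j))

IsMaxInducedKtt : ∀ {n₁ n₂} → (Fin n₁ → Fin n₂ → Bool) → ℕ → Set
IsMaxInducedKtt E t = HasInducedKtt E t × (∀ s → HasInducedKtt E s → s ≤ t)

-- Transitive partitions. A partition {V₁,…,V_k} is given by the class map
-- f : V → Fin k (class index i ↦ V_{i+1}); surjectivity = classes nonempty.

Surjective : ∀ {A : Set} {k} → (A → Fin k) → Set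
Surjective {A} {k} f = ∀ (i : Fin k) → ∃ λ (v : A) → f v ≡ i

Dominates : ∀ {n₁ n₂ k} → (Fin n₁ → Fin n₂ → Bool) → (Vtx n₁ n₂ → Fin k)
          → Fin k → Fin k → Set
Dominates {n₁} {n₂} E f i j =
  ∀ (v : Vtx n₁ n₂) → f v ≡ j → ∃ λ (u : Vtx n₁ n₂) → f u ≡ i × Adj E u v

IsTransitivePartition : ∀ {n₁ n₂} → (Fin n₁ → Fin n₂ → Bool) → (k : ℕ)
                      → (Vtx n₁ n₂ → Fin k) → Set
IsTransitivePartition E k f =
  Surjective f × (∀ (i j : Fin k) → i F.< j → Dominates E f i j)

IsTournamentTransitivePartition : ∀ {n₁ n₂} → (Fin n₁ → Fin n₂ → Bool) → (k : ℕ)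
                                → (Vtx n₁ n₂ → Fin k) → Set
IsTournamentTransitivePartition E k f =
  IsTransitivePartition E k f × (∀ (i j : Fin k) → i F.< j → ¬ Dominates E f j i)

HasTransitivePartition : ∀ {n₁ n₂} → (Fin n₁ → Fin n₂ → Bool) → ℕ → Set
HasTransitivePartition {n₁} {n₂} E k =
  Σ (Vtx n₁ n₂ → Fin k) λ f → IsTransitivePartition E k f

HasTournamentTransitivePartition : ∀ {n₁ n₂} → (Fin n₁ → Fin n₂ → Bool) → ℕ → Set
HasTournamentTransitivePartition {n₁} {n₂} E k =
  Σ (Vtx n₁ n₂ → Fin k) λ f → IsTournamentTransitivePartition E k f

TrEq : ∀ {n₁ n₂} → (Fin n₁ → Fin n₂ → Bool) → ℕ → Set
TrEq E k = HasTransitivePartition E k × (∀ m → HasTransitivePartition E m → m ≤ k)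

TTrEq : ∀ {n₁ n₂} → (Fin n₁ → Fin n₂ → Bool) → ℕ → Set
TTrEq E k = HasTournamentTransitivePartition E k
          × (∀ m → HasTournamentTransitivePartition E m → m ≤ k)

-- 1-based index access: "x_i y_j ∈ E" (both vertices exist and are adjacent)

EdgeIdx : ∀ {n₁ n₂} → (Fin n₁ → Fin n₂ → Bool) → ℕ → ℕ → Set
EdgeIdx {n₁} {n₂} E i j =
  Σ (Fin n₁) λ a → Σ (Fin n₂) λ b → suc (toℕ a) ≡ i × suc (toℕ b) ≡ j × E a b ≡ true

countTrue : ∀ {n} → (Fin n → Bool) → ℕ
countTrue {zero}  p = 0
countTrue {suc n} p with p F.zero
... | true  = suc (countTrue (λ i → p (F.suc i)))
... | false = countTrue (λ i → p (F.suc i))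

deg : ∀ {n₁ n₂} → (Fin n₁ → Fin n₂ → Bool) → Vtx n₁ n₂ → ℕ
deg E (inj₁ a) = countTrue (λ b → E a b)
deg E (inj₂ b) = countTrue (λ a → E a b)

-- v ∈ (X ∖ X_t) ∪ {y_{t+2}, …, y_{n₂}}
InZSet : ∀ {n₁ n₂} → ℕ → Vtx n₁ n₂ → Set
InZSet t (inj₁ a) = t ≤ toℕ a
InZSet t (inj₂ b) = suc t ≤ toℕ b

{-# OPTIONS --safe #-}
module Submission where

-- Classes are indexed from 0, so class i is the paper's V_{i+1}, and x_{i+1}, y_{i+1} have index i.
--
-- Lower bound: put x_{i+1} (i < t) and y_{i+1} (i ≤ t) in class i, z_{k+1} in class t−k−2 and every
-- other vertex in class 0. In a chain graph every neighbourhood is an initial segment of the other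
-- side, so a vertex of degree d sees exactly the vertices of index < d there. Each vertex has degree
-- at least its class, which gives domination downwards; z_{k+1} has degree at most t−k−1, so it has
-- no neighbour above its own class, and neither has y_t, because every x lies below class t.
--
-- Upper bound: by the Type-II(a) non-edges, every neighbour of x_{t+1}, x_{t+2}, … is among
-- y_1, …, y_{t−2}. In a transitive partition with K + 2 ≥ t + 2 classes some x = p and some y = q lie
-- in classes ≥ K, so both have neighbours in every class below K. Counting vertices of
-- y_1, …, y_{t−2} in distinct classes shows first that p is among x_1, …, x_t, and then that every
-- class r < K contains one of x_1, …, x_t: otherwise every y adjacent to class r is among
-- y_1, …, y_{t−2}, and q with one such y from each other class below K gives K > t − 2 of them.
-- So x_1, …, x_t meet K + 1 > t classes.

open import Defs
open import Data.Bool using (Bool; true; false)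
open import Data.Empty using (⊥; ⊥-elim)
open import Data.Fin using (Fin; toℕ; fromℕ<)
import Data.Fin as F
open import Data.Fin.Properties using (toℕ-injective; toℕ<n; toℕ-fromℕ<; fromℕ<-injective; any?; injective⇒≤)
open import Data.Nat using (ℕ; zero; suc; _∸_; _≤_; _<_; z≤n; s≤s; z<s; _≤?_; _<?_; _≟_)
open import Data.Nat.Properties
open import Data.Product using (∃; ∃₂; _×_; _,_; proj₁; proj₂; map₂)
open import Data.Sum using (inj₁; inj₂)
open import Data.Sum.Properties using (≡-dec)
open import Data.Vec.Functional using (_∷_; updateAt)
open import Data.Vec.Functional.Properties using (updateAt-updates; updateAt-minimal)
open import Function using (_∘_; const; case_of_)
open import Function.Definitions using (Injective)
open import Relation.Binary.Definitions using (tri<; tri≈; tri>)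
open import Relation.Nullary using (¬_; Dec; yes; no; contradiction)
open import Relation.Nullary.Decidable using (_×-dec_)
open import Relation.Binary.PropositionalEquality using (_≡_; _≢_; refl; sym; trans; cong; subst; module ≡-Reasoning)

DownClosed : ∀ {n} → (Fin n → Bool) → Set
DownClosed p = ∀ {i j} → toℕ i ≤ toℕ j → p j ≡ true → p i ≡ true

private
  tail-downClosed : ∀ {n} {p : Fin (suc n) → Bool} → DownClosed p → DownClosed (p ∘ F.suc)
  tail-downClosed dc i≤j = dc (s≤s i≤j)

true⇒<countTrue : ∀ {n} {p : Fin n → Bool} → DownClosed p
                → ∀ {i} → p i ≡ true → toℕ i < countTrue p
true⇒<countTrue {suc n} {p} dc {i} pi with p F.zero in p0
true⇒<countTrue {suc n} {p} dc {F.zero}  pi | true = s≤s z≤n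
true⇒<countTrue {suc n} {p} dc {F.suc i} pi | true = s≤s (true⇒<countTrue (tail-downClosed dc) pi)
... | false = case trans (sym p0) (dc z≤n pi) of λ ()

<countTrue⇒true : ∀ {n} {p : Fin n → Bool} → DownClosed p
                → ∀ {m} → m < countTrue p → ∃ λ i → toℕ i ≡ m × p i ≡ true
<countTrue⇒true {suc n} {p} dc {m} m< with p F.zero in p0
<countTrue⇒true {suc n} {p} dc {zero}  m<        | true = F.zero , refl , p0
<countTrue⇒true {suc n} {p} dc {suc m} (s≤s m<) | true =
  let i , i≡m , pi = <countTrue⇒true (tail-downClosed dc) m< in F.suc i , cong suc i≡m , pi
... | false =
  let _ , _ , pi = <countTrue⇒true (tail-downClosed dc) m< in case trans (sym p0) (dc z≤n pi) of λ ()

low-representatives⇒≤ : ∀ {m n s} (label : Fin n → ℕ) (ι : Fin m → ℕ) → Injective _≡_ _≡_ ι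
                      → (∀ c → ∃ λ v → toℕ v < s × label v ≡ ι c) → m ≤ s
low-representatives⇒≤ {m} {s = s} label ι ι-injective representative = injective⇒≤ slot-injective
  where
  slot : Fin m → Fin s
  slot c = fromℕ< (proj₁ (proj₂ (representative c)))

  slot-injective : Injective _≡_ _≡_ slot
  slot-injective {c} {c'} eq = ι-injective (begin
    ι c                               ≡⟨ sym (proj₂ (proj₂ (representative c))) ⟩
    label (proj₁ (representative c))  ≡⟨ cong label (toℕ-injective (fromℕ<-injective _ _ _ _ eq)) ⟩
    label (proj₁ (representative c')) ≡⟨ proj₂ (proj₂ (representative c')) ⟩
    ι c'                              ∎)
    where open ≡-Reasoning

∷-injective : ∀ {m d} {h : Fin m → ℕ} → Injective _≡_ _≡_ h → (∀ c → h c < d)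
            → Injective _≡_ _≡_ (d ∷ h)
∷-injective _       _   {F.zero}  {F.zero}   _  = refl
∷-injective _       h<d {F.zero}  {F.suc c'} eq = contradiction eq (>⇒≢ (h<d c'))
∷-injective _       h<d {F.suc c} {F.zero}   eq = contradiction eq (<⇒≢ (h<d c))
∷-injective h-injective _ {F.suc c} {F.suc c'} eq = cong F.suc (h-injective eq)

updateAt-toℕ-injective : ∀ {m} (r : Fin m) {d} → (∀ {c} → c ≢ r → toℕ c < d)
                       → Injective _≡_ _≡_ (updateAt toℕ r (const d))
updateAt-toℕ-injective r fresh {c} {c'} eq with c F.≟ r | c' F.≟ r
... | yes refl | yes refl = refl
... | yes refl | no c'≢r  = contradiction
  (trans (sym (updateAt-updates r toℕ)) (trans eq (updateAt-minimal c' r toℕ c'≢r))) (>⇒≢ (fresh c'≢r))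
... | no c≢r   | yes refl = contradiction
  (trans (sym (updateAt-minimal c r toℕ c≢r)) (trans eq (updateAt-updates r toℕ))) (<⇒≢ (fresh c≢r))
... | no c≢r   | no c'≢r  = toℕ-injective
  (trans (sym (updateAt-minimal c r toℕ c≢r)) (trans eq (updateAt-minimal c' r toℕ c'≢r)))

idx : ∀ {n₁ n₂} → Vtx n₁ n₂ → ℕ
idx (inj₁ a) = toℕ a
idx (inj₂ b) = toℕ b

module ChainOrdered {n₁ n₂} {E : Fin n₁ → Fin n₂ → Bool} (chain : IsChainOrdered E) where

  edge-downward : ∀ {a a' b b'} → toℕ a' ≤ toℕ a → toℕ b' ≤ toℕ b → E a b ≡ true → E a' b' ≡ true
  edge-downward {a} {a'} {b} {b'} a'≤a b'≤b e = proj₁ chain a' a b' a'≤a (proj₂ chain b' b a b'≤b e)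

  neighbour-idx<deg : ∀ {u w} → Adj E u w → idx u < deg E w
  neighbour-idx<deg {inj₂ _} {inj₁ _} = true⇒<countTrue (edge-downward ≤-refl)
  neighbour-idx<deg {inj₁ _} {inj₂ _} = true⇒<countTrue (λ le → edge-downward le ≤-refl)

  <deg⇒neighbour : ∀ w {m} → m < deg E w → ∃ λ u → idx u ≡ m × Adj E u w
  <deg⇒neighbour (inj₁ _) m<deg =
    let b , b≡m , e = <countTrue⇒true (edge-downward ≤-refl) m<deg in inj₂ b , b≡m , e
  <deg⇒neighbour (inj₂ _) m<deg =
    let a , a≡m , e = <countTrue⇒true (λ le → edge-downward le ≤-refl) m<deg in inj₁ a , a≡m , e

  non-edge⇒neighbours-below : ∀ {i j} → ¬ EdgeIdx E (suc i) (suc j)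
                            → ∀ {a b} → i ≤ toℕ a → E a b ≡ true → toℕ b < j
  non-edge⇒neighbours-below {i} {j} ¬edge {a} {b} i≤a e with toℕ b <? j
  ... | yes b<j = b<j
  ... | no b≮j = contradiction
    ( a' , b' , cong suc (toℕ-fromℕ< _) , cong suc (toℕ-fromℕ< _)
    , edge-downward (≤-trans (≤-reflexive (toℕ-fromℕ< _)) i≤a)
                    (≤-trans (≤-reflexive (toℕ-fromℕ< _)) (≮⇒≥ b≮j)) e)
    ¬edge
    where
    a' : Fin n₁
    a' = fromℕ< (≤-<-trans i≤a (toℕ<n a))
    b' : Fin n₂
    b' = fromℕ< (≤-<-trans (≮⇒≥ b≮j) (toℕ<n b))

module TransitivePartition {n₁ n₂ k} {E : Fin n₁ → Fin n₂ → Bool} {f : Vtx n₁ n₂ → Fin k}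
  (transitive : IsTransitivePartition E k f) where

  class : Vtx n₁ n₂ → ℕ
  class v = toℕ (f v)

  below : ∀ v {i} → i < class v → ∃ λ u → class u ≡ i × Adj E u v
  below v {i} i<v =
    let u , fu≡i , adj = proj₂ transitive (fromℕ< i<k) (f v)
                                 (subst (_< class v) (sym (toℕ-fromℕ< i<k)) i<v) v refl
    in u , trans (cong toℕ fu≡i) (toℕ-fromℕ< i<k) , adj
    where
    i<k : i < k
    i<k = <-trans i<v (toℕ<n (f v))

  below-X : ∀ a {i} → i < class (inj₁ a) → ∃ λ b → class (inj₂ b) ≡ i × E a b ≡ true
  below-X a i<a with below (inj₁ a) i<a
  ... | inj₂ b , b≡i , e = b , b≡i , e

  below-Y : ∀ b {i} → i < class (inj₂ b) → ∃ λ a → class (inj₁ a) ≡ i × E a b ≡ true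
  below-Y b i<b with below (inj₂ b) i<b
  ... | inj₁ a , a≡i , e = a , a≡i , e

  high-on-both-sides : ∀ {K} → suc K < k
                     → (∃ λ a → K ≤ class (inj₁ a)) × (∃ λ b → K ≤ class (inj₂ b))
  high-on-both-sides {K} K+1<k =
    let v , fv≡K+1 = proj₁ transitive (fromℕ< K+1<k)
        v≡K+1 = trans (cong toℕ fv≡K+1) (toℕ-fromℕ< K+1<k)
        u , u≡K , adj = below v (≤-reflexive (sym v≡K+1))
    in opposite u v adj (≤-reflexive (sym u≡K)) (≤-trans (n≤1+n K) (≤-reflexive (sym v≡K+1)))
    where
    opposite : ∀ u v → Adj E u v → K ≤ class u → K ≤ class v
             → (∃ λ a → K ≤ class (inj₁ a)) × (∃ λ b → K ≤ class (inj₂ b))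
    opposite (inj₁ a) (inj₂ b) _ a≥K b≥K = (a , a≥K) , (b , b≥K)
    opposite (inj₂ b) (inj₁ a) _ b≥K a≥K = (a , a≥K) , (b , b≥K)

module Labelling {n₁ n₂ k} (E : Fin n₁ → Fin n₂ → Bool)
  (label : Vtx n₁ n₂ → ℕ) (label<k : ∀ v → label v < k) where

  partition : Vtx n₁ n₂ → Fin k
  partition v = fromℕ< (label<k v)

  private
    partition≡ : ∀ {v i} → label v ≡ toℕ i → partition v ≡ i
    partition≡ eq = toℕ-injective (trans (toℕ-fromℕ< _) eq)

    label≡ : ∀ {v i} → partition v ≡ i → label v ≡ toℕ i
    label≡ eq = trans (sym (toℕ-fromℕ< _)) (cong toℕ eq)

  isTransitive : (∀ {i} → i < k → ∃ λ v → label v ≡ i)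
               → (∀ v {i} → i < label v → ∃ λ u → label u ≡ i × Adj E u v)
               → IsTransitivePartition E k partition
  isTransitive inhabited dominated = surjective , dominates
    where
    surjective : Surjective partition
    surjective i = let v , v≡i = inhabited (toℕ<n i) in v , partition≡ v≡i

    dominates : ∀ i j → i F.< j → Dominates E partition i j
    dominates i j i<j v v∈j =
      let u , u≡i , adj = dominated v (subst (toℕ i <_) (sym (label≡ v∈j)) i<j)
      in u , partition≡ u≡i , adj

  isTournament : (∀ {i} → i < k → ∃ λ v → label v ≡ i)
               → (∀ v {i} → i < label v → ∃ λ u → label u ≡ i × Adj E u v)
               → (∀ {i} → suc i < k → ∃ λ w → label w ≡ i × ∀ u → Adj E u w → label u ≤ i)
               → IsTournamentTransitivePartition E k partition
  isTournament inhabited dominated isolated = isTransitive inhabited dominated , undominated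
    where
    undominated : ∀ i j → i F.< j → ¬ Dominates E partition j i
    undominated i j i<j dominates =
      let w , w≡i , neighbours≤i = isolated (≤-<-trans i<j (toℕ<n j))
          u , u∈j , adj = dominates w (partition≡ w≡i)
      in <⇒≱ i<j (subst (_≤ toℕ i) (label≡ u∈j) (neighbours≤i u adj))

module _ {n₁ n₂} (E : Fin n₁ → Fin n₂ → Bool) {s t} (s<t : s < t)
  (sparse : ∀ {a b} → t ≤ toℕ a → E a b ≡ true → toℕ b < s) where

  private
    module LargePartition {K} {f : Vtx n₁ n₂ → Fin (suc (suc K))}
      (transitive : IsTransitivePartition E _ f) (t≤K : t ≤ K) where

      open TransitivePartition transitive

      s≱K : ¬ K ≤ s
      s≱K = <⇒≱ (<-≤-trans s<t t≤K)

      high-X-is-low : ∀ {p} → K ≤ class (inj₁ p) → toℕ p < t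
      high-X-is-low {p} K≤p with toℕ p <? t
      ... | yes p<t = p<t
      ... | no p≮t =
        contradiction (low-representatives⇒≤ (class ∘ inj₂) toℕ toℕ-injective neighbour) s≱K
        where
        neighbour : ∀ (c : Fin K) → ∃ λ b → toℕ b < s × class (inj₂ b) ≡ toℕ c
        neighbour c = let b , b∈c , e = below-X p (<-≤-trans (toℕ<n c) K≤p)
                      in b , sparse (≮⇒≥ p≮t) e , b∈c

      linked-to-class : ∀ {p} → K ≤ class (inj₁ p)
                      → (x : Fin n₁) (r : Fin K) → class (inj₁ x) ≡ toℕ r → ∀ {c} → c ≢ r
                      → ∃₂ λ b x' → class (inj₂ b) ≡ toℕ c × class (inj₁ x') ≡ toℕ r
                                  × E x' b ≡ true
      linked-to-class {p} K≤p x r x∈r {c} c≢r with <-cmp (toℕ c) (toℕ r)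
      ... | tri< c<r _ _ =
        let b , b∈c , e = below-X x (subst (toℕ c <_) (sym x∈r) c<r) in b , x , b∈c , x∈r , e
      ... | tri≈ _ c≡r _ = contradiction (toℕ-injective c≡r) c≢r
      ... | tri> _ _ r<c =
        let b , b∈c , _ = below-X p (<-≤-trans (toℕ<n c) K≤p)
            x' , x'∈r , e = below-Y b (subst (toℕ r <_) (sym b∈c) r<c)
        in b , x' , b∈c , x'∈r , e

      low-X-in-class : ∀ {p q} → K ≤ class (inj₁ p) → K ≤ class (inj₂ q)
                     → (r : Fin K) → ∃ λ x → toℕ x < t × class (inj₁ x) ≡ toℕ r
      low-X-in-class {p} {q} K≤p K≤q r with any? (λ x → toℕ x <? t ×-dec class (inj₁ x) ≟ toℕ r)
      ... | yes found = found
      ... | no none = contradiction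
        (low-representatives⇒≤ (class ∘ inj₂) ι
          (updateAt-toℕ-injective r λ {c} _ → <-≤-trans (toℕ<n c) K≤q) representative)
        s≱K
        where
        ι : Fin K → ℕ
        ι = updateAt toℕ r (const (class (inj₂ q)))

        linked-is-low : ∀ {x b} → class (inj₁ x) ≡ toℕ r → E x b ≡ true → toℕ b < s
        linked-is-low x∈r = sparse (≮⇒≥ λ x<t → none (_ , x<t , x∈r))

        q-neighbour-in-r : ∃ λ x → class (inj₁ x) ≡ toℕ r × E x q ≡ true
        q-neighbour-in-r = below-Y q (<-≤-trans (toℕ<n r) K≤q)

        representative : ∀ c → ∃ λ b → toℕ b < s × class (inj₂ b) ≡ ι c
        representative c with c F.≟ r
        ... | yes refl =
          let _ , x∈r , e = q-neighbour-in-r in q , linked-is-low x∈r e , sym (updateAt-updates r toℕ)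
        ... | no c≢r =
          let x , x∈r , _ = q-neighbour-in-r
              b , _ , b∈c , x'∈r , e = linked-to-class K≤p x r x∈r c≢r
          in b , linked-is-low x'∈r e , trans b∈c (sym (updateAt-minimal c r toℕ c≢r))

      no-high-pair : ∀ {p q} → K ≤ class (inj₁ p) → K ≤ class (inj₂ q) → ⊥
      no-high-pair {p} {q} K≤p K≤q = <⇒≱ (s≤s t≤K)
        (low-representatives⇒≤ (class ∘ inj₁) (class (inj₁ p) ∷ toℕ)
                                (∷-injective toℕ-injective λ c → <-≤-trans (toℕ<n c) K≤p) representative)
        where
        representative : ∀ c → ∃ λ x → toℕ x < t × class (inj₁ x) ≡ (class (inj₁ p) ∷ toℕ) c
        representative F.zero    = p , high-X-is-low K≤p , refl
        representative (F.suc c) = low-X-in-class K≤p K≤q c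

      impossible : ⊥
      impossible = let (_ , K≤p) , (_ , K≤q) = high-on-both-sides ≤-refl in no-high-pair K≤p K≤q

  transitivity≤ : ∀ k → HasTransitivePartition E k → k ≤ suc t
  transitivity≤ zero          _                = z≤n
  transitivity≤ (suc zero)    _                = s≤s z≤n
  transitivity≤ (suc (suc K)) (_ , transitive) with t ≤? K
  ... | yes t≤K = ⊥-elim (LargePartition.impossible transitive t≤K)
  ... | no t≰K  = s≤s (≰⇒> t≰K)

∸suc-hits : ∀ {i t} → suc (suc i) ≤ t → ∃ λ ℓ → ℓ < t ∸ 1 × t ∸ suc ℓ ≡ suc i
∸suc-hits {i} i+2≤t with m≤n⇒∃[o]m+o≡n i+2≤t
... | ℓ , refl = ℓ , m<n+m ℓ {suc i} z<s , m+n∸n≡m (suc i) ℓ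

module LowerBound {n₁ n₂} {E : Fin n₁ → Fin n₂ → Bool} (chain : IsChainOrdered E) {t}
  (edge : EdgeIdx E t (suc t))
  (z : Fin (t ∸ 1) → Vtx n₁ n₂) (z-injective : Injective _≡_ _≡_ z) (z-outside : ∀ k → InZSet t (z k))
  (z-degree : ∀ k → deg E (z k) ≤ t ∸ suc (toℕ k) × t ∸ suc (toℕ k) ∸ 1 ≤ deg E (z k)) where

  open ChainOrdered chain

  private
    xₜ : Fin n₁
    xₜ = proj₁ edge

    yₜ₊₁ : Fin n₂
    yₜ₊₁ = proj₁ (proj₂ edge)

    1+xₜ≡t : suc (toℕ xₜ) ≡ t
    1+xₜ≡t = proj₁ (proj₂ (proj₂ edge))

    yₜ₊₁≡t : toℕ yₜ₊₁ ≡ t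
    yₜ₊₁≡t = suc-injective (proj₁ (proj₂ (proj₂ (proj₂ edge))))

    xₜyₜ₊₁ : E xₜ yₜ₊₁ ≡ true
    xₜyₜ₊₁ = proj₂ (proj₂ (proj₂ (proj₂ edge)))

    t-1<t : t ∸ 1 < t
    t-1<t = ∸-monoʳ-< z<s (subst (1 ≤_) 1+xₜ≡t (s≤s z≤n))

    t<n₂ : t < n₂
    t<n₂ = subst (_< n₂) yₜ₊₁≡t (toℕ<n yₜ₊₁)

  Low : Vtx n₁ n₂ → Set
  Low (inj₁ a) = toℕ a < t
  Low (inj₂ b) = toℕ b ≤ t

  low? : ∀ v → Dec (Low v)
  low? (inj₁ a) = toℕ a <? t
  low? (inj₂ b) = toℕ b ≤? t

  idx<t⇒low : ∀ v → idx v < t → Low v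
  idx<t⇒low (inj₁ _) a<t = a<t
  idx<t⇒low (inj₂ _) b<t = <⇒≤ b<t

  low⇒idx≤t : ∀ v → Low v → idx v ≤ t
  low⇒idx≤t (inj₁ _) a<t = <⇒≤ a<t
  low⇒idx≤t (inj₂ _) b≤t = b≤t

  outside⇒¬low : ∀ v → InZSet t v → ¬ Low v
  outside⇒¬low (inj₁ _) t≤a a<t = <⇒≱ a<t t≤a
  outside⇒¬low (inj₂ _) t<b b≤t = <⇒≱ t<b b≤t

  low⇒idx≤deg : ∀ v → Low v → idx v ≤ deg E v
  low⇒idx≤deg (inj₁ a) a<t = <⇒≤ (<-≤-trans a<t (<⇒≤ (subst (_< deg E (inj₁ a)) yₜ₊₁≡t
    (neighbour-idx<deg {inj₂ yₜ₊₁} {inj₁ a} (edge-downward a≤xₜ ≤-refl xₜyₜ₊₁)))))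
    where
    a≤xₜ : toℕ a ≤ toℕ xₜ
    a≤xₜ = ≤-pred (subst (suc (toℕ a) ≤_) (sym 1+xₜ≡t) a<t)
  low⇒idx≤deg (inj₂ b) b≤t = ≤-trans b≤t (subst (_≤ deg E (inj₂ b)) 1+xₜ≡t
    (neighbour-idx<deg {inj₁ xₜ} {inj₂ b} (edge-downward ≤-refl b≤yₜ₊₁ xₜyₜ₊₁)))
    where
    b≤yₜ₊₁ : toℕ b ≤ toℕ yₜ₊₁
    b≤yₜ₊₁ = subst (toℕ b ≤_) (sym yₜ₊₁≡t) b≤t

  z? : ∀ v → Dec (∃ λ k → z k ≡ v)
  z? v = any? λ k → ≡-dec F._≟_ F._≟_ (z k) v

  class : Vtx n₁ n₂ → ℕ
  class v with low? v | z? v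
  ... | yes _ | _           = idx v
  ... | no _  | yes (k , _) = t ∸ suc (toℕ k) ∸ 1
  ... | no _  | no _        = 0

  class-low : ∀ v → Low v → class v ≡ idx v
  class-low v l with low? v | z? v
  ... | yes _ | _ = refl
  ... | no ¬l | _ = contradiction l ¬l

  class-z : ∀ k → class (z k) ≡ t ∸ suc (toℕ k) ∸ 1
  class-z k with low? (z k) | z? (z k)
  ... | yes l | _                  = contradiction l (outside⇒¬low (z k) (z-outside k))
  ... | no _  | yes (k' , zk'≡zk)  = cong (λ k → t ∸ suc (toℕ k) ∸ 1) (z-injective zk'≡zk)
  ... | no _  | no none            = contradiction (k , refl) none

  class≤t : ∀ v → class v ≤ t
  class≤t v with low? v | z? v
  ... | yes l | _           = low⇒idx≤t v l
  ... | no _  | yes (k , _) = ≤-trans (m∸n≤m _ 1) (m∸n≤m t (suc (toℕ k)))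
  ... | no _  | no _        = z≤n

  class-X<t : ∀ a → class (inj₁ a) < t
  class-X<t a with low? (inj₁ a) | z? (inj₁ a)
  ... | yes a<t | _           = a<t
  ... | no _    | yes (k , _) = ≤-<-trans (∸-monoˡ-≤ 1 (m∸n≤m t (suc (toℕ k)))) t-1<t
  ... | no _    | no _        = ≤-<-trans z≤n t-1<t

  class≤deg : ∀ v → class v ≤ deg E v
  class≤deg v with low? v | z? v
  ... | yes l | _              = low⇒idx≤deg v l
  ... | no _  | yes (k , refl) = proj₂ (z-degree k)
  ... | no _  | no _           = z≤n

  class-of-low-idx : ∀ u → idx u < t → class u ≡ idx u
  class-of-low-idx u u<t = class-low u (idx<t⇒low u u<t)

  y-at : ∀ {i} → i ≤ t → Fin n₂
  y-at i≤t = fromℕ< (≤-<-trans i≤t t<n₂)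

  class-y-at : ∀ {i} (i≤t : i ≤ t) → class (inj₂ (y-at i≤t)) ≡ i
  class-y-at i≤t =
    trans (class-low (inj₂ (y-at i≤t)) (subst (_≤ t) (sym (toℕ-fromℕ< _)) i≤t)) (toℕ-fromℕ< _)

  inhabited : ∀ {i} → i < suc t → ∃ λ v → class v ≡ i
  inhabited (s≤s i≤t) = inj₂ (y-at i≤t) , class-y-at i≤t

  dominated : ∀ v {i} → i < class v → ∃ λ u → class u ≡ i × Adj E u v
  dominated v {i} i<v =
    let u , u≡i , adj = <deg⇒neighbour v (<-≤-trans i<v (class≤deg v))
        i<t = <-≤-trans i<v (class≤t v)
    in u , trans (class-of-low-idx u (subst (_< t) (sym u≡i) i<t)) u≡i , adj

  z-isolated : ∀ {i} → suc (suc i) ≤ t → ∃ λ w → class w ≡ i × ∀ u → Adj E u w → class u ≤ i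
  z-isolated {i} i+2≤t =
    z k , trans (class-z k) (cong (_∸ 1) deg-bound)
        , λ u adj → subst (_≤ i) (sym (class-of-low-idx u (≤-<-trans (neighbour≤i u adj) i<t)))
                                 (neighbour≤i u adj)
    where
    i<t : i < t
    i<t = ≤-trans (n≤1+n (suc i)) i+2≤t

    hit : ∃ λ ℓ → ℓ < t ∸ 1 × t ∸ suc ℓ ≡ suc i
    hit = ∸suc-hits i+2≤t

    k : Fin (t ∸ 1)
    k = fromℕ< (proj₁ (proj₂ hit))

    deg-bound : t ∸ suc (toℕ k) ≡ suc i
    deg-bound = trans (cong (λ m → t ∸ suc m) (toℕ-fromℕ< _)) (proj₂ (proj₂ hit))

    neighbour≤i : ∀ u → Adj E u (z k) → idx u ≤ i
    neighbour≤i u adj = ≤-pred (<-≤-trans (neighbour-idx<deg adj)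
                                 (subst (deg E (z k) ≤_) deg-bound (proj₁ (z-degree k))))

  isolated : ∀ {i} → suc i < suc t → ∃ λ w → class w ≡ i × ∀ u → Adj E u w → class u ≤ i
  isolated {i} (s≤s i<t) with suc (suc i) ≤? t
  ... | yes i+2≤t = z-isolated i+2≤t
  ... | no i+2≰t  = inj₂ (y-at (<⇒≤ i<t)) , class-y-at (<⇒≤ i<t)
                  , λ { (inj₁ a) _ → ≤-pred (≤-trans (class-X<t a) (≤-pred (≰⇒> i+2≰t))) }

  tournamentPartition : HasTournamentTransitivePartition E (suc t)
  tournamentPartition = _ , isTournament inhabited dominated isolated
    where open Labelling E class (s≤s ∘ class≤t)

non-edge-at-t∸2 : ∀ {n₁ n₂} {E : Fin n₁ → Fin n₂ → Bool} {t} → 0 < t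
                → ¬ EdgeIdx E (suc t) t → ¬ EdgeIdx E (suc t) (t ∸ 1) → ¬ EdgeIdx E (suc t) (suc (t ∸ 2))
non-edge-at-t∸2 {t = suc zero}    _ ¬edge _ = ¬edge
non-edge-at-t∸2 {t = suc (suc _)} _ _ ¬edge = ¬edge

t∸2<t : ∀ {t} → 0 < t → t ∸ 2 < t
t∸2<t {suc t} _ = s≤s (m∸n≤m t 1)

mainTheorem4 : (n₁ n₂ : ℕ) (E : Fin n₁ → Fin n₂ → Bool) (t : ℕ)
    → IsChainOrdered E
    → ¬ IsCompleteBipartite E
    → IsMaxInducedKtt E t
    → t < n₁
    → EdgeIdx E t (suc t)
    → ¬ EdgeIdx E (suc t) t
    → ¬ EdgeIdx E (suc t) (t ∸ 1)
    → (z : Fin (t ∸ 1) → Vtx n₁ n₂)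
    → Injective _≡_ _≡_ z
    → (∀ k → InZSet t (z k))
    → (∀ k → deg E (z k) ≤ t ∸ suc (toℕ k) × t ∸ suc (toℕ k) ∸ 1 ≤ deg E (z k))
    → TTrEq E (suc t) × TrEq E (suc t)
mainTheorem4 n₁ n₂ E t chain _ _ _ edge@(_ , _ , 1+xₜ≡t , _) ¬xₜ₊₁yₜ ¬xₜ₊₁yₜ₋₁
             z z-injective z-outside z-degree =
  (tournament , λ m → upper m ∘ forget) , (forget tournament , upper)
  where
  0<t : 0 < t
  0<t = subst (0 <_) 1+xₜ≡t z<s

  tournament : HasTournamentTransitivePartition E (suc t)
  tournament = LowerBound.tournamentPartition chain edge z z-injective z-outside z-degree

  forget : ∀ {k} → HasTournamentTransitivePartition E k → HasTransitivePartition E k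
  forget = map₂ proj₁

  upper : ∀ m → HasTransitivePartition E m → m ≤ suc t
  upper = transitivity≤ E (t∸2<t 0<t)
    (ChainOrdered.non-edge⇒neighbours-below chain (non-edge-at-t∸2 0<t ¬xₜ₊₁yₜ ¬xₜ₊₁yₜ₋₁))
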